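{- Let $p>2$ be a prime and $d\geq 2$ an integer with $p-1=df$. Let $\omega$ be a fixed generator of $\mathbb{F}_p^*$, let $(i,j)$, $0\leq i,j\leq d-1$, be the cyclotomic numbers of order $d$, and let $\theta=0$ if $f$ is even and $\theta=d/2$ if $f$ is odd. Let $a\in\mathbb{F}_p^*\setminus\mathbb{F}_p^{*d}$ and $\alpha\equiv \mathrm{ind}_\omega(a)\pmod d$. Then $s_d(p,a)=2$ if $(\alpha+\theta,\theta)\neq 0$, and otherwise $$s_d(p,a)=\min\{s\ :\ \exists\, 0\leq i_2,\dots,i_{s-1}\leq d-1 \text{ with } (\alpha+\theta,i_2)(i_2,i_3)\cdots(i_{s-1},\theta)\neq 0\}.$$
   Context: All indices of cyclotomic numbers are taken modulo $d$. The cyclotomic numbers of order $d$ are $(i,j)=\#\{(u,v): 0\leq u,v\leq f-1,\ 1+\omega^{du+i}\equiv \omega^{dv+j}\pmod p\}$. $\mathbb{F}_p^{*d}$ is the subgroup of $d$-th powers in $\mathbb{F}_p^*$, and $\mathrm{ind}_\omega(a)$ is the discrete logarithm of $a$ to base $\omega$. For $a\in\mathbb{F}_p^*$, $s_d(p,a)=\min\{k\geq 1: a=\sum_{i=1}^k a_i^d \text{ for some } a_i\in\mathbb{F}_p^*\}$. In the minimum, for $s=3$ the product is read as $(\alpha+\theta,i_2)(i_2,\theta)$. -}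

module Defs where

open import Data.Nat using (ℕ; zero; suc; _+_; _*_; _∸_; _^_; _≤_; _<_; NonZero)
open import Data.Nat.DivMod using (_%_; _/_)
open import Data.Fin using (Fin; toℕ)
open import Data.List using (List; []; _∷_; length; filter; cartesianProduct; allFin; _++_)
open import Data.Vec using (Vec; toList)
import Data.Vec as V
open import Data.Vec.Relation.Unary.All using (All)
open import Data.Product using (Σ; _×_; _,_; ∃)
open import Data.Nat using (_≟_)
open import Relation.Binary.PropositionalEquality using (_≡_; _≢_)

cyc : (p d f ω : ℕ) .{{_ : NonZero p}} .{{_ : NonZero d}} → ℕ → ℕ → ℕ
cyc p d f ω i j =
  length (filter (λ uv → (1 + ω ^ (d * toℕ (Data.Product.proj₁ uv) + i % d)) % p
                          ≟ (ω ^ (d * toℕ (Data.Product.proj₂ uv) + j % d)) % p)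
                 (cartesianProduct (allFin f) (allFin f)))

IsGenerator : (p ω : ℕ) .{{_ : NonZero p}} → Set
IsGenerator p ω = ∀ x → x % p ≢ 0 → ∃ λ k → ω ^ k % p ≡ x % p

IsDthPower : (p d a : ℕ) .{{_ : NonZero p}} → Set
IsDthPower p d a = ∃ λ x → x % p ≢ 0 × x ^ d % p ≡ a % p

SumOfDthPowers : (p d a : ℕ) .{{_ : NonZero p}} → ℕ → Set
SumOfDthPowers p d a k =
  Σ (Vec ℕ k) λ xs → All (λ x → x % p ≢ 0) xs
                   × V.sum (V.map (λ x → x ^ d) xs) % p ≡ a % p

IsLeastPos : (ℕ → Set) → ℕ → Set
IsLeastPos P n = 1 ≤ n × P n × (∀ m → 1 ≤ m → P m → n ≤ m)

IsWaringNumber : (p d a : ℕ) .{{_ : NonZero p}} → ℕ → Set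
IsWaringNumber p d a n = IsLeastPos (SumOfDthPowers p d a) n

theta : ℕ → ℕ → ℕ
theta d f with f % 2
... | zero = 0
... | suc _ = d / 2

chainProd : (p d f ω : ℕ) .{{_ : NonZero p}} .{{_ : NonZero d}} → List ℕ → ℕ
chainProd p d f ω (x ∷ y ∷ rest) = cyc p d f ω x y * chainProd p d f ω (y ∷ rest)
chainProd p d f ω _ = 1

ChainNonzero : (p d f ω : ℕ) .{{_ : NonZero p}} .{{_ : NonZero d}} → ℕ → ℕ → ℕ → Set
ChainNonzero p d f ω start end s =
  2 ≤ s × Σ (Vec (Fin d) (s ∸ 2)) λ is →
    chainProd p d f ω (start ∷ (toList (V.map toℕ is) ++ (end ∷ []))) ≢ 0

-- n is the least s with P s (the set being over s ≥ 2 by construction of P)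
IsLeast : (ℕ → Set) → ℕ → Set
IsLeast P n = P n × (∀ m → P m → n ≤ m)

module Submission where

-- Write Cᵢ for the coset ω^i 𝔽ₚ*ᵈ. The cyclotomic number (i,j) is nonzero exactly when some
-- x ∈ Cᵢ has 1 + x ∈ Cⱼ, equivalently (scaling by d-th powers) when every y ∈ Cᵢ has y + zᵈ ∈ Cⱼ
-- for some z ≠ 0. As -1 = ω^((p-1)/2) lies in C_θ, we have -a ∈ C_{α+θ} and -z₁ᵈ ∈ C_θ, so
-- a = z₁ᵈ + ⋯ + zₛᵈ is a walk -a, -a + z₂ᵈ, …, -a + z₂ᵈ + ⋯ + zₛᵈ = -z₁ᵈ from C_{α+θ} to C_θ.
-- A nonzero chain (α+θ, i₂, …, i_{s-1}, θ) produces such a walk, hence s terms; conversely a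
-- representation yields such a chain unless some partial sum vanishes, which gives a shorter
-- representation.

open import Defs
open import Data.Nat using (ℕ; _+_; _*_; _∸_; _^_; _≤_; _<_; NonZero)
open import Data.Nat.DivMod using (_%_)
open import Data.Nat.Primality using (Prime)
open import Data.Product using (Σ; _×_; ∃)
open import Relation.Binary.PropositionalEquality using (_≡_; _≢_)
open import Relation.Nullary using (¬_)

open import Data.Nat
  using (zero; suc; pred; _/_; _≟_; _≤?_; s≤s; z≤n; z<s; s≤s⁻¹; ≢-nonZero; ≢-nonZero⁻¹; >-nonZero; nonTrivial⇒n>1)
open import Data.Nat.Properties
open import Data.Nat.DivMod
open import Data.Nat.Divisibility using (_∣_; divides; n∣m⇒m%n≡0; m%n≡0⇒n∣m; m∣m*n)
open import Data.Nat.Primality using (euclidsLemma; prime⇒nonTrivial; prime⇒irreducible; prime[2])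
open import Data.Nat.Induction using (<-rec)
open import Data.Nat.Tactic.RingSolver using (solve-∀)
open import Data.Fin using (Fin; toℕ; fromℕ<)
open import Data.Fin.Properties using (pigeonhole; toℕ-fromℕ<; toℕ<n; any?)
open import Data.List using (List; []; _∷_; length; filter; cartesianProduct; allFin; _++_)
open import Data.List.Membership.Propositional using (_∈_)
open import Data.List.Membership.Propositional.Properties
  using (∈-filter⁺; ∈-filter⁻; ∈-cartesianProduct⁺; ∈-allFin)
open import Data.List.Relation.Unary.Any using (here)
open import Data.Vec using (Vec; []; _∷_; toList)
import Data.Vec as V
open import Data.Vec.Relation.Unary.All using (All; []; _∷_)
open import Data.Product using (_,_; proj₁; proj₂; map₂)
open import Data.Sum using (_⊎_; inj₁; inj₂; [_,_]′)
import Data.Sum as Sum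
open import Data.Empty using (⊥; ⊥-elim)
open import Function using (_∘_; id; case_of_)
open import Level using (0ℓ)
open import Relation.Nullary using (Dec; yes; no)
open import Relation.Nullary.Decidable using (map′; _×-dec_; ¬?)
open import Relation.Binary.Bundles using (Setoid)
open import Relation.Binary.Structures using (IsEquivalence)
open import Relation.Binary.PropositionalEquality using (refl; sym; trans; cong; cong₂; subst; module ≡-Reasoning)
import Relation.Binary.Reasoning.Setoid as SetoidReasoning

*-≢0 : ∀ {m n} → m ≢ 0 → n ≢ 0 → m * n ≢ 0
*-≢0 {m} m≢0 n≢0 = [ m≢0 , n≢0 ]′ ∘ m*n≡0⇒m≡0∨n≡0 m

*-≢0⁻ : ∀ {m n} → m * n ≢ 0 → m ≢ 0 × n ≢ 0
*-≢0⁻ {m} mn≢0 = (λ { refl → mn≢0 refl }) , (λ { refl → mn≢0 (*-zeroʳ m) })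

^-distribʳ-* : ∀ k x y → (x * y) ^ k ≡ x ^ k * y ^ k
^-distribʳ-* zero    x y = refl
^-distribʳ-* (suc k) x y = trans (cong (x * y *_) (^-distribʳ-* k x y)) (regroup x y (x ^ k) (y ^ k))
  where
  regroup : ∀ x y a b → x * y * (a * b) ≡ x * a * (y * b)
  regroup = solve-∀

length≢0⇒∃∈ : ∀ {A : Set} {xs : List A} → length xs ≢ 0 → ∃ λ x → x ∈ xs
length≢0⇒∃∈ {xs = []}    []≢0 = ⊥-elim ([]≢0 refl)
length≢0⇒∃∈ {xs = x ∷ _} _    = x , here refl

∈⇒length≢0 : ∀ {A : Set} {x : A} {xs : List A} → x ∈ xs → length xs ≢ 0
∈⇒length≢0 {xs = _ ∷ _} _ ()

∃-Vec-Fin? : ∀ {m} k {P : Vec (Fin m) k → Set} → (∀ v → Dec (P v)) → Dec (∃ P)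
∃-Vec-Fin? zero    P? = map′ ([] ,_) (λ { ([] , Pv) → Pv }) (P? [])
∃-Vec-Fin? (suc k) P? = map′ (λ (i , v , Pv) → i ∷ v , Pv) (λ { (i ∷ v , Pv) → i , v , Pv })
                             (any? λ i → ∃-Vec-Fin? k (P? ∘ (i ∷_)))

least : ∀ {P : ℕ → Set} → (∀ m → Dec (P m)) → ∀ {m} → P m → ∃ λ s → IsLeast P s
least {P} P? {m} = <-rec (λ m → P m → ∃ (IsLeast P)) search m
  where
  search : ∀ m → (∀ {j} → j < m → P j → ∃ (IsLeast P)) → P m → ∃ (IsLeast P)
  search m smaller Pm with anyUpTo? P? m
  ... | yes (j , j<m , Pj) = smaller j<m Pj
  ... | no ∄j<m            = m , Pm , λ j Pj → ≮⇒≥ (λ j<m → ∄j<m (j , j<m , Pj))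

odd-prime⇒2∣pred : ∀ n → Prime (suc n) → 2 < suc n → 2 ∣ n
odd-prime⇒2∣pred n p-prime 2<p with n % 2 in n%2≡ | m%n<n n 2
... | zero        | _ = m%n≡0⇒n∣m n 2 n%2≡
... | suc (suc _) | s≤s (s≤s ())
... | suc zero    | _ = ⊥-elim ([ (λ ()) , (λ 2≡p → <-irrefl 2≡p 2<p) ]′ (prime⇒irreducible p-prime 2∣p))
  where
  2∣p : 2 ∣ suc n
  2∣p = divides (suc (n / 2)) (cong suc (trans (m≡m%n+[m/n]*n n 2) (cong (_+ n / 2 * 2) n%2≡)))

theta-double : ∀ d f → 2 ∣ d * f → theta d f + theta d f ≡ f % 2 * d
theta-double d f 2∣df with f % 2 in f%2≡ | m%n<n f 2
... | zero        | _ = refl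
... | suc (suc _) | s≤s (s≤s ())
... | suc zero    | _ = begin
  d / 2 + d / 2  ≡⟨ double (d / 2) ⟩
  d / 2 * 2      ≡⟨ m/n*n≡m 2∣d ⟩
  d              ≡⟨ +-identityʳ d ⟨
  1 * d          ∎
  where
  open ≡-Reasoning
  double : ∀ x → x + x ≡ x * 2
  double = solve-∀
  2∤f : ¬ 2 ∣ f
  2∤f 2∣f = case trans (sym f%2≡) (n∣m⇒m%n≡0 f 2 2∣f) of λ ()
  2∣d : 2 ∣ d
  2∣d = [ id , ⊥-elim ∘ 2∤f ]′ (euclidsLemma d f prime[2] 2∣df)

-- θ is the residue of (p - 1) / 2 = d f / 2 modulo d.
theta-half : ∀ d f → 2 ∣ d * f →
             (d * (f / 2) + theta d f) + (d * (f / 2) + theta d f) ≡ d * f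
theta-half d f 2∣df = begin
  (d * (f / 2) + θ) + (d * (f / 2) + θ)  ≡⟨ regroup d (f / 2) θ ⟩
  d * (f / 2 * 2) + (θ + θ)              ≡⟨ cong (d * (f / 2 * 2) +_) (theta-double d f 2∣df) ⟩
  d * (f / 2 * 2) + f % 2 * d            ≡⟨ factor d (f / 2) (f % 2) ⟩
  d * (f % 2 + f / 2 * 2)                ≡⟨ cong (d *_) (m≡m%n+[m/n]*n f 2) ⟨
  d * f                                  ∎
  where
  open ≡-Reasoning
  θ : ℕ
  θ = theta d f
  regroup : ∀ d q t → (d * q + t) + (d * q + t) ≡ d * (q * 2) + (t + t)
  regroup = solve-∀
  factor : ∀ d q r → d * (q * 2) + r * d ≡ d * (r + q * 2)
  factor = solve-∀

module Congruence (n : ℕ) where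

  p : ℕ
  p = suc n

  infix 4 _≈_
  record _≈_ (x y : ℕ) : Set where
    constructor mk≈
    field %-≡ : x % p ≡ y % p
  open _≈_ public

  ≈-isEquivalence : IsEquivalence _≈_
  ≈-isEquivalence = record
    { refl  = mk≈ refl
    ; sym   = λ (mk≈ e) → mk≈ (sym e)
    ; trans = λ (mk≈ e) (mk≈ e′) → mk≈ (trans e e′)
    }

  ≈-setoid : Setoid 0ℓ 0ℓ
  ≈-setoid = record { isEquivalence = ≈-isEquivalence }

  open IsEquivalence ≈-isEquivalence public
    using () renaming (refl to ≈-refl; sym to ≈-sym; trans to ≈-trans)
  module ≈-Reasoning = SetoidReasoning ≈-setoid

  ≡⇒≈ : ∀ {x y} → x ≡ y → x ≈ y
  ≡⇒≈ refl = ≈-refl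

  +-cong-≈ : ∀ {x y u v} → x ≈ y → u ≈ v → x + u ≈ y + v
  +-cong-≈ {x} {y} {u} {v} (mk≈ e) (mk≈ e′) = mk≈ (begin
    (x + u) % p           ≡⟨ %-distribˡ-+ x u p ⟩
    (x % p + u % p) % p   ≡⟨ cong₂ (λ a b → (a + b) % p) e e′ ⟩
    (y % p + v % p) % p   ≡⟨ %-distribˡ-+ y v p ⟨
    (y + v) % p           ∎)
    where open ≡-Reasoning

  *-cong-≈ : ∀ {x y u v} → x ≈ y → u ≈ v → x * u ≈ y * v
  *-cong-≈ {x} {y} {u} {v} (mk≈ e) (mk≈ e′) = mk≈ (begin
    (x * u) % p           ≡⟨ %-distribˡ-* x u p ⟩
    (x % p * (u % p)) % p ≡⟨ cong₂ (λ a b → (a * b) % p) e e′ ⟩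
    (y % p * (v % p)) % p ≡⟨ %-distribˡ-* y v p ⟨
    (y * v) % p           ∎)
    where open ≡-Reasoning

  ^-cong-≈ : ∀ {x y} → x ≈ y → ∀ k → x ^ k ≈ y ^ k
  ^-cong-≈ e zero    = ≈-refl
  ^-cong-≈ e (suc k) = *-cong-≈ e (^-cong-≈ e k)

  ∣⇒≈0 : ∀ {x} → p ∣ x → x ≈ 0
  ∣⇒≈0 {x} p∣x = mk≈ (n∣m⇒m%n≡0 x p p∣x)

  ≈0⇒∣ : ∀ {x} → x ≈ 0 → p ∣ x
  ≈0⇒∣ {x} (mk≈ e) = m%n≡0⇒n∣m x p e

  -- Since p ≡ 1 + n, multiplication by n is negation modulo p.
  infix 8 -_
  -_ : ℕ → ℕ
  - x = n * x

  +-inverseʳ-≈ : ∀ x → x + - x ≈ 0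
  +-inverseʳ-≈ x = ∣⇒≈0 (m∣m*n x)

  +-identityʳ-≈ : ∀ {x y} → y ≈ 0 → x + y ≈ x
  +-identityʳ-≈ {x} y≈0 = ≈-trans (+-cong-≈ ≈-refl y≈0) (≡⇒≈ (+-identityʳ x))

  +≈0⇒≈- : ∀ {x y} → x + y ≈ 0 → x ≈ - y
  +≈0⇒≈- {x} {y} x+y≈0 = begin
    x               ≈⟨ +-identityʳ-≈ (+-inverseʳ-≈ y) ⟨
    x + (y + - y)   ≡⟨ +-assoc x y (- y) ⟨
    x + y + - y     ≈⟨ +-cong-≈ x+y≈0 ≈-refl ⟩
    - y             ∎
    where open ≈-Reasoning

  -‿involutive-≈ : ∀ x → - - x ≈ x
  -‿involutive-≈ x = ≈-sym (+≈0⇒≈- (+-inverseʳ-≈ x))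

  -+≈0⇒≈ : ∀ {x y} → - x + y ≈ 0 → y ≈ x
  -+≈0⇒≈ {x} {y} -x+y≈0 =
    ≈-trans (+≈0⇒≈- (≈-trans (≡⇒≈ (+-comm y (- x))) -x+y≈0)) (-‿involutive-≈ x)

  +≈⇒-+≈- : ∀ {x y z} → x + y ≈ z → - z + y ≈ - x
  +≈⇒-+≈- {x} {y} {z} x+y≈z = begin
    - z + y              ≈⟨ +-cong-≈ (*-cong-≈ (≈-refl {n}) (≈-sym x+y≈z)) (≈-refl {y}) ⟩
    - (x + y) + y        ≡⟨ regroup n x y ⟩
    - x + (y + - y)      ≈⟨ +-identityʳ-≈ (+-inverseʳ-≈ y) ⟩
    - x                  ∎
    where
    open ≈-Reasoning
    regroup : ∀ m x y → m * (x + y) + y ≡ m * x + (y + m * y)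
    regroup = solve-∀

  -[-+]+≈ : ∀ x y → - (- x + y) + y ≈ x
  -[-+]+≈ x y = ≈-trans (+≈⇒-+≈- (≈-refl { - x + y})) (-‿involutive-≈ x)

  ≈0? : ∀ x → Dec (x ≈ 0)
  ≈0? x = map′ mk≈ %-≡ (x % p ≟ 0)

  <p⇒≈⇒≡ : ∀ {x y} → x < p → y < p → x ≈ y → x ≡ y
  <p⇒≈⇒≡ x<p y<p (mk≈ e) = trans (sym (m<n⇒m%n≡m x<p)) (trans e (m<n⇒m%n≡m y<p))

  ^-periodic-≈ : ∀ {x o} → x ^ o ≈ 1 → ∀ k m → x ^ (k + m * o) ≈ x ^ k
  ^-periodic-≈ {x} {o} x^o≈1 k m = begin
    x ^ (k + m * o)       ≡⟨ ^-distribˡ-+-* x k (m * o) ⟩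
    x ^ k * x ^ (m * o)   ≡⟨ cong (λ e → x ^ k * x ^ e) (*-comm m o) ⟩
    x ^ k * x ^ (o * m)   ≡⟨ cong (x ^ k *_) (^-*-assoc x o m) ⟨
    x ^ k * (x ^ o) ^ m   ≈⟨ *-cong-≈ (≈-refl {x ^ k}) (^-cong-≈ x^o≈1 m) ⟩
    x ^ k * 1 ^ m         ≡⟨ cong (x ^ k *_) (^-zeroˡ m) ⟩
    x ^ k * 1             ≡⟨ *-identityʳ (x ^ k) ⟩
    x ^ k                 ∎
    where open ≈-Reasoning

  ^-%-≈ : ∀ {x o} .{{_ : NonZero o}} → x ^ o ≈ 1 → ∀ k → x ^ k ≈ x ^ (k % o)
  ^-%-≈ {x} {o} x^o≈1 k = begin
    x ^ k                   ≡⟨ cong (x ^_) (m≡m%n+[m/n]*n k o) ⟩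
    x ^ (k % o + k / o * o) ≈⟨ ^-periodic-≈ x^o≈1 (k % o) (k / o) ⟩
    x ^ (k % o)             ∎
    where open ≈-Reasoning

module PrimeField (n : ℕ) (p-prime : Prime (suc n)) where

  open Congruence n public

  1<p : 1 < p
  1<p = nonTrivial⇒n>1 p {{prime⇒nonTrivial p-prime}}

  1≉0 : ¬ 1 ≈ 0
  1≉0 1≈0 with <p⇒≈⇒≡ 1<p z<s 1≈0
  ... | ()

  *≈0⇒≈0⊎≈0 : ∀ x y → x * y ≈ 0 → x ≈ 0 ⊎ y ≈ 0
  *≈0⇒≈0⊎≈0 x y xy≈0 = Sum.map ∣⇒≈0 ∣⇒≈0 (euclidsLemma x y p-prime (≈0⇒∣ xy≈0))

  ^≉0 : ∀ {x} → ¬ x ≈ 0 → ∀ k → ¬ x ^ k ≈ 0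
  ^≉0 x≉0 zero    = 1≉0
  ^≉0 x≉0 (suc k) = [ x≉0 , ^≉0 x≉0 k ]′ ∘ *≈0⇒≈0⊎≈0 _ _

  *-cancelˡ-≈ : ∀ {c x y} → ¬ c ≈ 0 → c * x ≈ c * y → x ≈ y
  *-cancelˡ-≈ {c} {x} {y} c≉0 cx≈cy =
    [ ⊥-elim ∘ c≉0 , (λ x-y≈0 → ≈-trans (+≈0⇒≈- x-y≈0) (-‿involutive-≈ y)) ]′
      (*≈0⇒≈0⊎≈0 c (x + - y) c[x-y]≈0)
    where
    open ≈-Reasoning
    distrib : ∀ m c x y → c * (x + m * y) ≡ c * x + m * (c * y)
    distrib = solve-∀
    c[x-y]≈0 : c * (x + - y) ≈ 0
    c[x-y]≈0 = begin
      c * (x + - y)      ≡⟨ distrib n c x y ⟩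
      c * x + - (c * y)  ≈⟨ +-cong-≈ cx≈cy ≈-refl ⟩
      c * y + - (c * y)  ≈⟨ +-inverseʳ-≈ (c * y) ⟩
      0                  ∎

module Generator (n : ℕ) (p-prime : Prime (suc n)) (2<p : 2 < suc n)
                 (ω : ℕ) (generator : IsGenerator (suc n) ω) where

  open PrimeField n p-prime public

  instance
    n≢0 : NonZero n
    n≢0 = >-nonZero (≤-trans (s≤s z≤n) (s≤s⁻¹ 2<p))

  log : ∀ {x} → ¬ x ≈ 0 → ∃ λ k → ω ^ k ≈ x
  log {x} x≉0 = map₂ mk≈ (generator x (x≉0 ∘ mk≈))

  -- 2 is a power of ω, whereas every power of 0 is 0 or 1.
  ω≉0 : ¬ ω ≈ 0
  ω≉0 ω≈0 with log {2} (λ 2≈0 → case <p⇒≈⇒≡ 2<p z<s 2≈0 of λ ())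
  ... | zero  , 1≈2 with <p⇒≈⇒≡ 1<p 2<p 1≈2
  ...   | ()
  ω≉0 ω≈0 | suc k , ω^k≈2 with <p⇒≈⇒≡ z<s 2<p (≈-trans (≈-sym (*-cong-≈ ω≈0 (≈-refl {ω ^ k}))) ω^k≈2)
  ...   | ()

  ω^≉0 : ∀ k → ¬ ω ^ k ≈ 0
  ω^≉0 = ^≉0 ω≉0

  nonzeroIndex : ∀ x → ¬ x ≈ 0 → Fin n
  nonzeroIndex x x≉0 = fromℕ< (∸-monoˡ-< (m%n<n x p) (n≢0⇒n>0 (x≉0 ∘ mk≈)))

  nonzeroIndex-injective : ∀ {x y} (x≉0 : ¬ x ≈ 0) (y≉0 : ¬ y ≈ 0) →
                           nonzeroIndex x x≉0 ≡ nonzeroIndex y y≉0 → x ≈ y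
  nonzeroIndex-injective {x} {y} x≉0 y≉0 same = mk≈
    (∸-cancelʳ-≡ (n≢0⇒n>0 (x≉0 ∘ mk≈)) (n≢0⇒n>0 (y≉0 ∘ mk≈))
      (trans (sym (toℕ-fromℕ< _)) (trans (cong toℕ same) (toℕ-fromℕ< _))))

  -- Pigeonhole: the n + 1 powers ω⁰, …, ωⁿ take at most n nonzero values.
  ω-order-bounded : ∃ λ o → 0 < o × o ≤ n × ω ^ o ≈ 1
  ω-order-bounded with pigeonhole (n<1+n n) (λ k → nonzeroIndex (ω ^ toℕ k) (ω^≉0 (toℕ k)))
  ... | i , j , i<j , same with m≤n⇒∃[o]m+o≡n i<j
  ...   | o , i+1+o≡j = suc o , z<s , ≤-trans (m≤n+m (suc o) (toℕ i)) (≤-trans j≥i+1+o (s≤s⁻¹ (toℕ<n j))) ,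
          ≈-sym (*-cancelˡ-≈ (ω^≉0 (toℕ i)) ω^i≈ω^i*ω^[1+o])
    where
    open ≈-Reasoning
    j≥i+1+o : toℕ i + suc o ≤ toℕ j
    j≥i+1+o = ≤-reflexive (trans (+-suc (toℕ i) o) i+1+o≡j)
    ω^i≈ω^i*ω^[1+o] : ω ^ toℕ i * 1 ≈ ω ^ toℕ i * ω ^ suc o
    ω^i≈ω^i*ω^[1+o] = begin
      ω ^ toℕ i * 1           ≡⟨ *-identityʳ (ω ^ toℕ i) ⟩
      ω ^ toℕ i               ≈⟨ nonzeroIndex-injective (ω^≉0 (toℕ i)) (ω^≉0 (toℕ j)) same ⟩
      ω ^ toℕ j               ≡⟨ cong (ω ^_) (trans (+-suc (toℕ i) o) i+1+o≡j) ⟨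
      ω ^ (toℕ i + suc o)     ≡⟨ ^-distribˡ-+-* ω (toℕ i) (suc o) ⟩
      ω ^ toℕ i * ω ^ suc o   ∎

  -- If ω^o ≈ 1 then every nonzero residue is a power ω^k with k < o.
  ω-order-minimal : ∀ o → 0 < o → ω ^ o ≈ 1 → n ≤ o
  ω-order-minimal o 0<o ω^o≈1 = ≮⇒≥ o<n⇒⊥
    where
    instance
      o≢0 : NonZero o
      o≢0 = >-nonZero 0<o
    residue≉0 : (r : Fin n) → ¬ suc (toℕ r) ≈ 0
    residue≉0 r r≈0 with <p⇒≈⇒≡ (s≤s (toℕ<n r)) z<s r≈0
    ... | ()
    exponent : Fin n → ℕ
    exponent r = proj₁ (log (residue≉0 r))
    reduced : (r : Fin n) → ω ^ (exponent r % o) ≈ suc (toℕ r)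
    reduced r = ≈-trans (≈-sym (^-%-≈ ω^o≈1 (exponent r))) (proj₂ (log (residue≉0 r)))
    o<n⇒⊥ : o < n → ⊥
    o<n⇒⊥ o<n with pigeonhole o<n (λ r → fromℕ< (m%n<n (exponent r) o))
    ... | r , r′ , r<r′ , same = <-irrefl (suc-injective (<p⇒≈⇒≡ (s≤s (toℕ<n r)) (s≤s (toℕ<n r′)) r≈r′)) r<r′
      where
      r≈r′ : suc (toℕ r) ≈ suc (toℕ r′)
      r≈r′ = ≈-trans (≈-sym (reduced r))
               (≈-trans (≡⇒≈ (cong (ω ^_) (trans (sym (toℕ-fromℕ< _)) (trans (cong toℕ same) (toℕ-fromℕ< _)))))
                        (reduced r′))

  ω^n≈1 : ω ^ n ≈ 1
  ω^n≈1 = order-n ω-order-bounded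
    where
    order-n : (∃ λ o → 0 < o × o ≤ n × ω ^ o ≈ 1) → ω ^ n ≈ 1
    order-n (o , 0<o , o≤n , ω^o≈1) =
      subst (λ e → ω ^ e ≈ 1) (≤-antisym o≤n (ω-order-minimal o 0<o ω^o≈1)) ω^o≈1

  fermat : ∀ {x} → ¬ x ≈ 0 → x ^ n ≈ 1
  fermat {x} x≉0 with log x≉0
  ... | k , ω^k≈x = begin
    x ^ n          ≈⟨ ^-cong-≈ (≈-sym ω^k≈x) n ⟩
    (ω ^ k) ^ n    ≡⟨ ^-*-assoc ω k n ⟩
    ω ^ (k * n)    ≈⟨ ^-periodic-≈ ω^n≈1 0 k ⟩
    1              ∎
    where open ≈-Reasoning

  *-inverse-≈ : ∀ {x} → ¬ x ≈ 0 → x * x ^ pred n ≈ 1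
  *-inverse-≈ {x} x≉0 = ≈-trans (≡⇒≈ (cong (x ^_) (suc-pred n))) (fermat x≉0)

  -- (x - 1)(x + 1) ≈ x² - 1 ≈ 0 for x = ω^h, and x ≈ 1 is excluded as 0 < h < n.
  ω^half≈-1 : ∀ h → h + h ≡ n → ω ^ h ≈ - 1
  ω^half≈-1 h h+h≡n =
    [ (λ x-1≈0 → ⊥-elim (<⇒≱ h<n (ω-order-minimal h 0<h (≈-trans (+≈0⇒≈- x-1≈0) (-‿involutive-≈ 1)))))
    , +≈0⇒≈-
    ]′ (*≈0⇒≈0⊎≈0 (x + - 1) (x + 1) product≈0)
    where
    open ≈-Reasoning
    x : ℕ
    x = ω ^ h
    0<h : 0 < h
    0<h = n≢0⇒n>0 λ { refl → ≢-nonZero⁻¹ n (sym h+h≡n) }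
    h<n : h < n
    h<n = subst (h <_) h+h≡n (m<m+n h 0<h)
    expand : ∀ m x → (x + m * 1) * (x + 1) ≡ x * x + (x + m * x) + m * 1
    expand = solve-∀
    product≈0 : (x + - 1) * (x + 1) ≈ 0
    product≈0 = begin
      (x + - 1) * (x + 1)      ≡⟨ expand n x ⟩
      x * x + (x + - x) + - 1  ≈⟨ +-cong-≈ (+-cong-≈ x²≈1 (+-inverseʳ-≈ x)) (≈-refl { - 1}) ⟩
      1 + - 1                  ≈⟨ +-inverseʳ-≈ 1 ⟩
      0                        ∎
      where
      x²≈1 : x * x ≈ 1
      x²≈1 = ≈-trans (≡⇒≈ (trans (sym (^-distribˡ-+-* ω h h)) (cong (ω ^_) h+h≡n))) ω^n≈1

module Cyclotomy (n d f ω : ℕ) .{{_ : NonZero d}} .{{_ : NonZero f}}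
                 (p-prime : Prime (suc n)) (2<p : 2 < suc n)
                 (generator : IsGenerator (suc n) ω) (n≡d*f : n ≡ d * f) where

  open Generator n p-prime 2<p ω generator public

  -- Class c x: x lies in the coset ω^c 𝔽ₚ*ᵈ, the cyclotomic class of index c mod d.
  Class : ℕ → ℕ → Set
  Class c x = ∃ λ A → ω ^ (d * A + c % d) ≈ x

  Class-resp-≈ : ∀ {c x y} → x ≈ y → Class c x → Class c y
  Class-resp-≈ x≈y (A , ω^≈x) = A , ≈-trans ω^≈x x≈y

  Class-cong : ∀ {c c′ x} → c % d ≡ c′ % d → Class c x → Class c′ x
  Class-cong {x = x} c≡c′ (A , ω^≈x) = A , subst (λ r → ω ^ (d * A + r) ≈ x) c≡c′ ω^≈x

  Class-intro : ∀ A r {x} → ω ^ (d * A + r) ≈ x → Class r x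
  Class-intro A r ω^≈x = A + r / d , ≈-trans (≡⇒≈ (cong (ω ^_) exponent)) ω^≈x
    where
    regroup : ∀ d A q m → d * (A + q) + m ≡ d * A + (m + q * d)
    regroup = solve-∀
    exponent : d * (A + r / d) + r % d ≡ d * A + r
    exponent = trans (regroup d A (r / d) (r % d)) (cong (d * A +_) (sym (m≡m%n+[m/n]*n r d)))

  ω^∈Class : ∀ k → Class k (ω ^ k)
  ω^∈Class k = Class-intro 0 k (≡⇒≈ (cong (λ e → ω ^ (e + k)) (*-zeroʳ d)))

  ω^d*∈Class0 : ∀ A → Class 0 (ω ^ (d * A))
  ω^d*∈Class0 A = Class-intro A 0 (≡⇒≈ (cong (ω ^_) (+-identityʳ (d * A))))

  Class-* : ∀ {i j x y} → Class i x → Class j y → Class (i + j) (x * y)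
  Class-* {i} {j} {x} {y} (A , ω^≈x) (B , ω^≈y) =
    Class-cong (sym (%-distribˡ-+ i j d)) (Class-intro (A + B) (i % d + j % d) ω^≈xy)
    where
    regroup : ∀ d A B r s → d * (A + B) + (r + s) ≡ (d * A + r) + (d * B + s)
    regroup = solve-∀
    ω^≈xy : ω ^ (d * (A + B) + (i % d + j % d)) ≈ x * y
    ω^≈xy = ≈-trans (≡⇒≈ (trans (cong (ω ^_) (regroup d A B (i % d) (j % d)))
                               (^-distribˡ-+-* ω (d * A + i % d) (d * B + j % d))))
                    (*-cong-≈ ω^≈x ω^≈y)

  ≉0⇒Class : ∀ {x} → ¬ x ≈ 0 → Σ (Fin d) λ i → Class (toℕ i) x
  ≉0⇒Class x≉0 with log x≉0
  ... | k , ω^k≈x = fromℕ< (m%n<n k d) ,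
        Class-cong (sym (trans (cong (_% d) (toℕ-fromℕ< _)) (m%n%n≡m%n k d)))
                   (Class-resp-≈ ω^k≈x (ω^∈Class k))

  ^d∈Class0 : ∀ {z} → ¬ z ≈ 0 → Class 0 (z ^ d)
  ^d∈Class0 {z} z≉0 with log z≉0
  ... | M , ω^M≈z = Class-resp-≈ (begin
    ω ^ (d * M)    ≡⟨ cong (ω ^_) (*-comm d M) ⟩
    ω ^ (M * d)    ≡⟨ ^-*-assoc ω M d ⟨
    (ω ^ M) ^ d    ≈⟨ ^-cong-≈ ω^M≈z d ⟩
    z ^ d          ∎) (ω^d*∈Class0 M)
    where open ≈-Reasoning

  Class0⇒^d : ∀ {x} → Class 0 x → ∃ λ z → ¬ z ≈ 0 × z ^ d ≈ x
  Class0⇒^d (A , ω^≈x) = ω ^ A , ω^≉0 A , ≈-trans (≡⇒≈ (trans (^-*-assoc ω A d) (cong (ω ^_) exponent))) ω^≈x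
    where
    exponent : A * d ≡ d * A + 0 % d
    exponent = trans (*-comm A d) (sym (trans (cong (d * A +_) (m*n%n≡0 0 d)) (+-identityʳ (d * A))))

  Class0-inverse : ∀ {u} → Class 0 u → ∃ λ v → Class 0 v × u * v ≈ 1
  Class0-inverse {u} u∈0 with Class0⇒^d u∈0
  ... | z , z≉0 , z^d≈u = (z ^ pred n) ^ d , ^d∈Class0 (^≉0 z≉0 (pred n)) , (begin
    u * (z ^ pred n) ^ d          ≈⟨ *-cong-≈ (≈-sym z^d≈u) (≈-refl {(z ^ pred n) ^ d}) ⟩
    z ^ d * (z ^ pred n) ^ d      ≡⟨ ^-distribʳ-* d z (z ^ pred n) ⟨
    (z * z ^ pred n) ^ d          ≈⟨ ^-cong-≈ (*-inverse-≈ z≉0) d ⟩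
    1 ^ d                         ≡⟨ ^-zeroˡ d ⟩
    1                             ∎)
    where open ≈-Reasoning

  Class-quotient : ∀ {i x y} → Class i x → Class i y → ∃ λ u → Class 0 u × u * x ≈ y
  Class-quotient {i} {x} {y} (A , ω^≈x) (U , ω^≈y) = quotient (Class0-inverse (ω^d*∈Class0 A))
    where
    open ≈-Reasoning
    r : ℕ
    r = i % d
    regroup : ∀ a b c e → a * b * (c * e) ≡ a * ((c * b) * e)
    regroup = solve-∀
    quotient : (∃ λ v → Class 0 v × ω ^ (d * A) * v ≈ 1) → ∃ λ u → Class 0 u × u * x ≈ y
    quotient (v , v∈0 , ω^dA*v≈1) = ω ^ (d * U) * v , Class-* (ω^d*∈Class0 U) v∈0 , (begin
      ω ^ (d * U) * v * x                        ≈⟨ *-cong-≈ (≈-refl {ω ^ (d * U) * v}) (≈-sym ω^≈x) ⟩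
      ω ^ (d * U) * v * ω ^ (d * A + r)          ≡⟨ cong (ω ^ (d * U) * v *_) (^-distribˡ-+-* ω (d * A) r) ⟩
      ω ^ (d * U) * v * (ω ^ (d * A) * ω ^ r)    ≡⟨ regroup (ω ^ (d * U)) v (ω ^ (d * A)) (ω ^ r) ⟩
      ω ^ (d * U) * ((ω ^ (d * A) * v) * ω ^ r)  ≈⟨ *-cong-≈ (≈-refl {ω ^ (d * U)}) (*-cong-≈ ω^dA*v≈1 (≈-refl {ω ^ r})) ⟩
      ω ^ (d * U) * (1 * ω ^ r)                  ≡⟨ cong (ω ^ (d * U) *_) (*-identityˡ (ω ^ r)) ⟩
      ω ^ (d * U) * ω ^ r                        ≡⟨ ^-distribˡ-+-* ω (d * U) r ⟨
      ω ^ (d * U + r)                            ≈⟨ ω^≈y ⟩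
      y                                          ∎)

  solution? : ∀ i j (uv : Fin f × Fin f) →
              Dec ((1 + ω ^ (d * toℕ (proj₁ uv) + i % d)) % p ≡ ω ^ (d * toℕ (proj₂ uv) + j % d) % p)
  solution? i j uv = (1 + ω ^ (d * toℕ (proj₁ uv) + i % d)) % p ≟ ω ^ (d * toℕ (proj₂ uv) + j % d) % p

  cyc≢0⇒∃ : ∀ i j → cyc p d f ω i j ≢ 0 → ∃ λ x → Class i x × Class j (1 + x)
  cyc≢0⇒∃ i j cyc≢0 =
    let ((u , v) , mem) = length≢0⇒∃∈ {xs = filter (solution? i j) pairs} cyc≢0
        solves = proj₂ (∈-filter⁻ (solution? i j) {xs = pairs} mem)
    in ω ^ (d * toℕ u + i % d) , (toℕ u , ≈-refl) , (toℕ v , ≈-sym (mk≈ solves))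
    where
    pairs : List (Fin f × Fin f)
    pairs = cartesianProduct (allFin f) (allFin f)

  -- Exponents of ω only matter modulo n = d f, so the witnesses can be taken below f.
  ω^-reduce : ∀ A r → ω ^ (d * A + r) ≈ ω ^ (d * toℕ (fromℕ< (m%n<n A f)) + r)
  ω^-reduce A r = begin
    ω ^ (d * A + r)                               ≡⟨ cong (λ e → ω ^ (d * e + r)) (m≡m%n+[m/n]*n A f) ⟩
    ω ^ (d * (A % f + A / f * f) + r)             ≡⟨ cong (ω ^_) (regroup d (A % f) (A / f) f r) ⟩
    ω ^ (d * (A % f) + r + A / f * (d * f))       ≡⟨ cong (λ e → ω ^ (d * (A % f) + r + A / f * e)) n≡d*f ⟨
    ω ^ (d * (A % f) + r + A / f * n)             ≈⟨ ^-periodic-≈ ω^n≈1 (d * (A % f) + r) (A / f) ⟩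
    ω ^ (d * (A % f) + r)                         ≡⟨ cong (λ e → ω ^ (d * e + r)) (toℕ-fromℕ< (m%n<n A f)) ⟨
    ω ^ (d * toℕ (fromℕ< (m%n<n A f)) + r)        ∎
    where
    open ≈-Reasoning
    regroup : ∀ d a q f r → d * (a + q * f) + r ≡ d * a + r + q * (d * f)
    regroup = solve-∀

  ∃⇒cyc≢0 : ∀ {i j x} → Class i x → Class j (1 + x) → cyc p d f ω i j ≢ 0
  ∃⇒cyc≢0 {i} {j} {x} (A , ω^≈x) (B , ω^≈1+x) =
    ∈⇒length≢0 (∈-filter⁺ (solution? i j) (∈-cartesianProduct⁺ (∈-allFin u) (∈-allFin v)) (%-≡ solves))
    where
    u v : Fin f
    u = fromℕ< (m%n<n A f)
    v = fromℕ< (m%n<n B f)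
    solves : 1 + ω ^ (d * toℕ u + i % d) ≈ ω ^ (d * toℕ v + j % d)
    solves = ≈-trans (+-cong-≈ (≈-refl {1}) (≈-trans (≈-sym (ω^-reduce A (i % d))) ω^≈x))
                     (≈-trans (≈-sym ω^≈1+x) (ω^-reduce B (j % d)))

  -- Scaling by a d-th power moves the witness x ∈ Cᵢ of (i,j) ≠ 0 to any given y ∈ Cᵢ.
  cyc≢0⇒step : ∀ {i j y} → cyc p d f ω i j ≢ 0 → Class i y →
               ∃ λ z → ¬ z ≈ 0 × Class j (y + z ^ d)
  cyc≢0⇒step {i} {j} {y} cyc≢0 y∈i =
    let (x , x∈i , 1+x∈j) = cyc≢0⇒∃ i j cyc≢0
        (u , u∈0 , ux≈y)  = Class-quotient x∈i y∈i
        (z , z≉0 , z^d≈u) = Class0⇒^d u∈0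
    in z , z≉0 , Class-resp-≈ (≈-trans (≡⇒≈ (expand u x)) (+-cong-≈ ux≈y (≈-sym z^d≈u))) (Class-* u∈0 1+x∈j)
    where
    expand : ∀ u x → u * (1 + x) ≡ u * x + u
    expand = solve-∀

  step⇒cyc≢0 : ∀ {i j y z} → Class i y → ¬ z ≈ 0 → Class j (y + z ^ d) →
               cyc p d f ω i j ≢ 0
  step⇒cyc≢0 {i} {j} {y} {z} y∈i z≉0 y+z^d∈j =
    let (v , v∈0 , z^d*v≈1) = Class0-inverse (^d∈Class0 z≉0)
        v[y+z^d]≈1+vy = ≈-trans (≡⇒≈ (expand v y (z ^ d))) (+-cong-≈ z^d*v≈1 (≈-refl {v * y}))
    in ∃⇒cyc≢0 (Class-* v∈0 y∈i) (Class-resp-≈ v[y+z^d]≈1+vy (Class-* v∈0 y+z^d∈j))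
    where
    expand : ∀ v y w → v * (y + w) ≡ w * v + v * y
    expand = solve-∀

  powerSum : ∀ {k} → Vec ℕ k → ℕ
  powerSum xs = V.sum (V.map (λ x → x ^ d) xs)

  NonzeroResidue : ℕ → Set
  NonzeroResidue x = x % p ≢ 0

  pathProduct : ℕ → ∀ {k} → Vec (Fin d) k → ℕ → ℕ
  pathProduct c is e = chainProd p d f ω (c ∷ (toList (V.map toℕ is) ++ (e ∷ [])))

  pathProduct≢0⇒walk : ∀ {k c e x} (is : Vec (Fin d) k) → pathProduct c is e ≢ 0 → Class c x →
                       Σ (Vec ℕ (suc k)) λ zs → All NonzeroResidue zs × Class e (x + powerSum zs)
  pathProduct≢0⇒walk {x = x} [] product≢0 x∈c =
    let (z , z≉0 , x+z^d∈e) = cyc≢0⇒step (proj₁ (*-≢0⁻ product≢0)) x∈c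
    in z ∷ [] , (z≉0 ∘ mk≈) ∷ [] , Class-resp-≈ (≡⇒≈ (cong (x +_) (sym (+-identityʳ (z ^ d))))) x+z^d∈e
  pathProduct≢0⇒walk {x = x} (i ∷ is) product≢0 x∈c =
    let (cyc≢0 , rest≢0)        = *-≢0⁻ product≢0
        (z , z≉0 , x+z^d∈i)     = cyc≢0⇒step cyc≢0 x∈c
        (zs , zs≢0 , sum∈e)     = pathProduct≢0⇒walk is rest≢0 x+z^d∈i
    in z ∷ zs , (z≉0 ∘ mk≈) ∷ zs≢0 , Class-resp-≈ (≡⇒≈ (+-assoc x (z ^ d) (powerSum zs))) sum∈e

  PrefixVanishes : ℕ → ℕ → Set
  PrefixVanishes x k = ∃ λ j → j < k × Σ (Vec ℕ (suc j)) λ ys → All NonzeroResidue ys × x + powerSum ys ≈ 0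

  walk⇒pathProduct≢0 : ∀ {k c e x} (zs : Vec ℕ (suc k)) → All NonzeroResidue zs → Class c x →
                       Class e (x + powerSum zs) →
                       PrefixVanishes x k ⊎ ∃ λ (is : Vec (Fin d) k) → pathProduct c is e ≢ 0
  walk⇒pathProduct≢0 {zero} {e = e} {x = x} (z ∷ []) (z≢0 ∷ []) x∈c sum∈e =
    inj₂ ([] , *-≢0 (step⇒cyc≢0 x∈c (z≢0 ∘ %-≡) x+z^d∈e) λ ())
    where
    x+z^d∈e : Class e (x + z ^ d)
    x+z^d∈e = Class-resp-≈ (≡⇒≈ (cong (x +_) (+-identityʳ (z ^ d)))) sum∈e
  walk⇒pathProduct≢0 {suc k} {x = x} (z ∷ zs) (z≢0 ∷ zs≢0) x∈c sum∈e with ≈0? (x + z ^ d)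
  ... | yes x+z^d≈0 =
    inj₁ (0 , z<s , z ∷ [] , z≢0 ∷ [] , ≈-trans (≡⇒≈ (cong (x +_) (+-identityʳ (z ^ d)))) x+z^d≈0)
  ... | no x+z^d≉0 =
    let (i , x+z^d∈i) = ≉0⇒Class x+z^d≉0
    in Sum.map extend (λ (is , product≢0) → i ∷ is , *-≢0 (step⇒cyc≢0 x∈c (z≢0 ∘ %-≡) x+z^d∈i) product≢0)
         (walk⇒pathProduct≢0 zs zs≢0 x+z^d∈i (Class-resp-≈ (≡⇒≈ (sym (+-assoc x (z ^ d) (powerSum zs)))) sum∈e))
    where
    extend : PrefixVanishes (x + z ^ d) k → PrefixVanishes x (suc k)
    extend (j , j<k , ys , ys≢0 , vanishes) =
      suc j , s≤s j<k , z ∷ ys , z≢0 ∷ ys≢0 , ≈-trans (≡⇒≈ (sym (+-assoc x (z ^ d) (powerSum ys)))) vanishes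

  θ : ℕ
  θ = theta d f

  2∣d*f : 2 ∣ d * f
  2∣d*f = subst (2 ∣_) n≡d*f (odd-prime⇒2∣pred n p-prime 2<p)

  -1∈Classθ : Class θ (- 1)
  -1∈Classθ = Class-intro (f / 2) θ (ω^half≈-1 (d * (f / 2) + θ) (trans (theta-half d f 2∣d*f) (sym n≡d*f)))

  Class-neg : ∀ {c x} → Class c x → Class (c + θ) (- x)
  Class-neg {x = x} x∈c = Class-resp-≈ (≡⇒≈ (swap n x)) (Class-* x∈c -1∈Classθ)
    where
    swap : ∀ m x → x * (m * 1) ≡ m * x
    swap = solve-∀

  Classθ⇒-∈Class0 : ∀ {x} → Class θ x → Class 0 (- x)
  Classθ⇒-∈Class0 = Class-cong θ+θ≡0 ∘ Class-neg
    where
    θ+θ≡0 : (θ + θ) % d ≡ 0 % d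
    θ+θ≡0 = trans (cong (_% d) (theta-double d f 2∣d*f)) (trans (m*n%n≡0 (f % 2) d) (sym (m*n%n≡0 0 d)))

module Waring (n d f ω : ℕ) .{{_ : NonZero d}} .{{_ : NonZero f}}
              (p-prime : Prime (suc n)) (2<p : 2 < suc n)
              (generator : IsGenerator (suc n) ω) (n≡d*f : n ≡ d * f)
              (a α : ℕ) (a≢0 : a % suc n ≢ 0) (a∉𝔽ᵈ : ¬ IsDthPower (suc n) d a)
              (a-index : ∃ λ k → ω ^ k % suc n ≡ a % suc n × α ≡ k % d) where

  open Cyclotomy n d f ω p-prime 2<p generator n≡d*f

  Chain : ℕ → Set
  Chain = ChainNonzero p d f ω (α + θ) θ

  SumOfPowers : ℕ → Set
  SumOfPowers = SumOfDthPowers p d a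

  -a∈Class : Class (α + θ) (- a)
  -a∈Class =
    let (k , ω^k≡a , α≡k%d) = a-index
    in Class-neg (Class-cong (sym (trans (cong (_% d) α≡k%d) (m%n%n≡m%n k d)))
                             (Class-resp-≈ (mk≈ ω^k≡a) (ω^∈Class k)))

  -- The walk from -a ends in Cθ, so its negation is a d-th power w^d completing the sum.
  Chain⇒Sum : ∀ {s} → Chain s → SumOfPowers s
  Chain⇒Sum (s≤s (s≤s z≤n) , is , product≢0) =
    let (zs , zs≢0 , sum∈θ)  = pathProduct≢0⇒walk is product≢0 -a∈Class
        (w , w≉0 , w^d≈-sum) = Class0⇒^d (Classθ⇒-∈Class0 sum∈θ)
    in w ∷ zs , (w≉0 ∘ mk≈) ∷ zs≢0 ,
       %-≡ (≈-trans (+-cong-≈ w^d≈-sum (≈-refl {powerSum zs})) (-[-+]+≈ a (powerSum zs)))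

  Sum⇒Chain : ∀ m → 1 ≤ m → SumOfPowers m → ∃ λ s → s ≤ m × Chain s
  Sum⇒Chain = <-rec (λ m → 1 ≤ m → SumOfPowers m → ∃ λ s → s ≤ m × Chain s) descend
    where
    descend : ∀ m → (∀ {j} → j < m → 1 ≤ j → SumOfPowers j → ∃ λ s → s ≤ j × Chain s) →
              1 ≤ m → SumOfPowers m → ∃ λ s → s ≤ m × Chain s
    descend (suc zero) _ _ (x ∷ [] , x≢0 ∷ [] , x^d≡a) =
      ⊥-elim (a∉𝔽ᵈ (x , x≢0 , trans (cong (_% p) (sym (+-identityʳ (x ^ d)))) x^d≡a))
    descend (suc (suc k)) shorter _ (w ∷ zs , w≢0 ∷ zs≢0 , sum≡a) =
      [ shorten , (λ (is , product≢0) → suc (suc k) , ≤-refl , s≤s (s≤s z≤n) , is , product≢0) ]′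
        (walk⇒pathProduct≢0 zs zs≢0 -a∈Class sum∈θ)
      where
      sum∈θ : Class θ (- a + powerSum zs)
      sum∈θ = Class-resp-≈ (≈-sym (+≈⇒-+≈- (mk≈ sum≡a))) (Class-neg (^d∈Class0 (w≢0 ∘ %-≡)))
      shorten : PrefixVanishes (- a) k → ∃ λ s → s ≤ suc (suc k) × Chain s
      shorten (j , j<k , ys , ys≢0 , vanishes) with shorter (s≤s (m<n⇒m<1+n j<k)) (s≤s z≤n) (ys , ys≢0 , %-≡ (-+≈0⇒≈ vanishes))
      ... | s , s≤1+j , chain = s , ≤-trans s≤1+j (m≤n⇒m≤1+n (s≤s (<⇒≤ j<k))) , chain

  a-as-sum-of-ones : SumOfPowers (a % p)
  a-as-sum-of-ones =
    let (xs , xs≢0 , sum≡) = ones (a % p)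
    in xs , xs≢0 , trans (cong (_% p) sum≡) (m%n%n≡m%n a p)
    where
    ones : ∀ k → Σ (Vec ℕ k) λ xs → All NonzeroResidue xs × powerSum xs ≡ k
    ones zero    = [] , [] , refl
    ones (suc k) =
      let (xs , xs≢0 , sum≡k) = ones k
      in 1 ∷ xs , (1≉0 ∘ mk≈) ∷ xs≢0 , cong₂ _+_ (^-zeroˡ d) sum≡k

  Chain? : ∀ s → Dec (Chain s)
  Chain? s = (2 ≤? s) ×-dec ∃-Vec-Fin? (s ∸ 2) (λ is → ¬? (pathProduct (α + θ) is θ ≟ 0))

  ∃leastChain : ∃ (IsLeast Chain)
  ∃leastChain = least Chain? (proj₂ (proj₂ (Sum⇒Chain (a % p) (n≢0⇒n>0 a≢0) a-as-sum-of-ones)))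

  cyc≢0⇒leastChain : cyc p d f ω (α + θ) θ ≢ 0 → IsLeast Chain 2
  cyc≢0⇒leastChain cyc≢0 = (≤-refl , [] , cyc≢0 ∘ trans (sym (*-identityʳ _))) , λ _ → proj₁

  leastChain⇒IsWaringNumber : ∀ {s} → IsLeast Chain s → IsWaringNumber p d a s
  leastChain⇒IsWaringNumber (chain , minimal) =
    ≤-trans (s≤s z≤n) (proj₁ chain) , Chain⇒Sum chain ,
    λ m 1≤m sum → let (s′ , s′≤m , chain′) = Sum⇒Chain m 1≤m sum in ≤-trans (minimal s′ chain′) s′≤m

theorem1 : (p d f ω a α : ℕ) .{{_ : NonZero p}} .{{_ : NonZero d}} →
    Prime p → 2 < p → 2 ≤ d → p ∸ 1 ≡ d * f →
    IsGenerator p ω →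
    a % p ≢ 0 → ¬ IsDthPower p d a →
    α < d → (∃ λ k → ω ^ k % p ≡ a % p × α ≡ k % d) →
    (cyc p d f ω (α + theta d f) (theta d f) ≢ 0 →
       IsWaringNumber p d a 2)
    × (cyc p d f ω (α + theta d f) (theta d f) ≡ 0 →
       Σ ℕ λ s → IsWaringNumber p d a s
               × IsLeast (ChainNonzero p d f ω (α + theta d f) (theta d f)) s)
theorem1 zero d f ω a α _ ()
theorem1 (suc n) d f ω a α p-prime 2<p _ n≡d*f generator a≢0 a∉𝔽ᵈ _ a-index =
    leastChain⇒IsWaringNumber ∘ cyc≢0⇒leastChain
  , λ _ → let (s , s-least) = ∃leastChain in s , leastChain⇒IsWaringNumber s-least , s-least
  where
  instance
    f≢0 : NonZero f
    f≢0 = ≢-nonZero λ { refl → <-irrefl (sym (trans n≡d*f (*-zeroʳ d))) (<-trans z<s (s≤s⁻¹ 2<p)) }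
  open Waring n d f ω p-prime 2<p generator n≡d*f a α a≢0 a∉𝔽ᵈ a-index
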